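{- Let $G$ be a finite simple graph of order $2n$ with a perfect matching. If $F(G)\leq \frac{n}{2}$, then $e(G)\geq \frac{n^2}{n-F(G)}$.
   Context: For a graph $G$ with a perfect matching $M$, a subset $S\subseteq M$ is a forcing set of $M$ if $S$ is contained in no perfect matching of $G$ other than $M$. $f(G,M)$ is the minimum size of a forcing set of $M$, and $F(G)=\max_M f(G,M)$ over all perfect matchings $M$ of $G$. $e(G)$ is the number of edges. -}

module Defs where

open import Data.Nat using (ℕ; suc; _+_; _*_; _≤_; _<_)
open import Data.Bool using (Bool; true; false; if_then_else_)
open import Data.Fin using (Fin; toℕ)
open import Data.List using (List; allFin; map; concatMap)
open import Data.Nat.ListAction using (sum)
open import Data.Product using (Σ; _×_; ∃)
open import Relation.Nullary using (¬_)
open import Relation.Nullary.Decidable using (⌊_⌋)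
open import Data.Fin.Properties using () renaming (_<?_ to _<ᶠ?_)
open import Relation.Binary.PropositionalEquality using (_≡_)

record Graph (m : ℕ) : Set where
  field
    adj   : Fin m → Fin m → Bool
    sym   : ∀ u v → adj u v ≡ adj v u
    irrefl : ∀ v → adj v v ≡ false
open Graph public

count : ∀ {m} → (Fin m → Bool) → ℕ
count {m} P = sum (map (λ v → if P v then 1 else 0) (allFin m))

edges : ∀ {m} → Graph m → ℕ
edges {m} G =
  sum (concatMap (λ u → map (λ v → if ⌊ u <ᶠ? v ⌋ then (if adj G u v then 1 else 0) else 0)
                             (allFin m))
                 (allFin m))

-- A perfect matching, encoded as its partner map: every vertex v is matched
-- with partner v; the matched pairs are edges, partners are symmetric
-- (partner (partner v) ≡ v) and no vertex is matched to itself.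
record PerfectMatching {m} (G : Graph m) : Set where
  field
    partner  : Fin m → Fin m
    isEdge   : ∀ v → adj G v (partner v) ≡ true
    invol    : ∀ v → partner (partner v) ≡ v
open PerfectMatching public

-- A subset S of the edges of M, given by the set of vertices it covers
-- (a vertex set closed under the partner map). Its number of edges is
-- half of the number of covered vertices.
record SubMatching {m} {G : Graph m} (M : PerfectMatching G) : Set where
  field
    covers : Fin m → Bool
    closed : ∀ v → covers (partner M v) ≡ covers v
open SubMatching public

SizeIs : ∀ {m} {G : Graph m} {M : PerfectMatching G} → SubMatching M → ℕ → Set
SizeIs S k = k + k ≡ count (covers S)

IsForcing : ∀ {m} {G : Graph m} (M : PerfectMatching G) → SubMatching M → Set
IsForcing {m} {G} M S =
  ∀ (M' : PerfectMatching G) →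
    (∀ v → covers S v ≡ true → partner M' v ≡ partner M v) →
    ∀ v → partner M' v ≡ partner M v

IsForcingNumber : ∀ {m} {G : Graph m} (M : PerfectMatching G) → ℕ → Set
IsForcingNumber M k =
  Σ (SubMatching M) (λ S → IsForcing M S × SizeIs S k) ×
  (∀ (S : SubMatching M) (j : ℕ) → IsForcing M S → SizeIs S j → k ≤ j)

IsMaxForcingNumber : ∀ {m} (G : Graph m) → ℕ → Set
IsMaxForcingNumber G k =
  Σ (PerfectMatching G) (λ M → IsForcingNumber M k) ×
  (∀ (M : PerfectMatching G) (j : ℕ) → IsForcingNumber M j → j ≤ k)

-- Take a perfect matching M with f(G,M) = F and a minimum forcing set S of M. Every vertex x
-- covered by S has a neighbour outside V(S): otherwise S minus the edge {x, M x} would still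
-- force M. Choosing one such exit edge per vertex of V(S) gives 2F distinct edges, each joining
-- V(S) to its complement, whereas the n edges of M never do; so e(G) ≥ n + 2F. Writing
-- n = 2F + k, (n + 2F)(n − F) = n² + F k ≥ n².
module Submission where

open import Defs hiding (sym)
open import Data.Bool using (Bool; true; false; if_then_else_; not; _∧_)
open import Data.Bool.Properties using (∧-zeroʳ; ¬-not) renaming (_≟_ to _≟ᵇ_)
open import Data.Fin using (Fin; zero; suc)
open import Data.Fin.Properties using (_≟_; _<?_; <-cmp; <-asym; any?)
open import Data.List using (List; []; _∷_; map; concatMap; allFin; tabulate)
open import Data.List.Properties using (map-tabulate)
open import Data.Nat using (ℕ; zero; suc; _+_; _*_; _∸_; _≤_; z≤n)
open import Data.Nat.ListAction using () renaming (sum to sumᴸ)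
open import Data.Nat.ListAction.Properties using (sum-++)
open import Data.Nat.Properties
  using ( +-0-commutativeMonoid; +-identityʳ; +-suc; +-assoc; +-mono-≤; *-monoˡ-≤; suc-injective
        ; <-irrefl; ≤-refl; m≤m+n; m≤n⇒∃[o]m+o≡n; m+n∸m≡n; n≡⌊n+n/2⌋; ⌊n/2⌋-mono; module ≤-Reasoning)
open import Algebra.Properties.CommutativeMonoid.Sum +-0-commutativeMonoid
  using (sum-syntax; ∑-distrib-+; ∑-comm; sum-cong-≗; sum-replicate-zero)
open import Data.Nat.Tactic.RingSolver using (solve-∀)
open import Data.Product using (∃; _×_; _,_; proj₁; proj₂)
open import Function using (_∘_; id; mk⇔)
open import Relation.Binary using (tri<; tri≈; tri>)
open import Relation.Binary.PropositionalEquality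
  using (_≡_; _≢_; refl; sym; trans; cong; cong₂; subst₂; module ≡-Reasoning)
open import Relation.Nullary using (yes; no; does; contradiction)
open import Relation.Nullary.Decidable using (⌊_⌋; _×-dec_; dec-false; does-⇔)

[_] : Bool → ℕ
[ b ] = if b then 1 else 0

[]-mono : ∀ {a b} → (a ≡ true → b ≡ true) → [ a ] ≤ [ b ]
[]-mono {false} _   = z≤n
[]-mono {true}  a⇒b rewrite a⇒b refl = ≤-refl

∧-swap : ∀ a b c → a ∧ (b ∧ c) ≡ b ∧ (a ∧ c)
∧-swap true  b c = refl
∧-swap false b c = sym (∧-zeroʳ b)

half-of-2+ : ∀ n {c} → n + n ≡ 2 + c → ∃ λ k → n ≡ suc k × k + k ≡ c
half-of-2+ zero    ()
half-of-2+ (suc k) eq = k , refl , suc-injective (trans (sym (+-suc k k)) (suc-injective eq))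

m+m≤n+n⇒m≤n : ∀ {a b} → a + a ≤ b + b → a ≤ b
m+m≤n+n⇒m≤n {a} {b} le = subst₂ _≤_ (sym (n≡⌊n+n/2⌋ a)) (sym (n≡⌊n+n/2⌋ b)) (⌊n/2⌋-mono le)

-- With n = 2F + k one has (n + 2F)(n − F) = n² + F k.
square-≤ : ∀ {n F e} → F + F ≤ n → n + F + F ≤ e → n * n ≤ e * (n ∸ F)
square-≤ {F = F} {e} 2F≤n n+2F≤e with m≤n⇒∃[o]m+o≡n 2F≤n
... | k , refl = begin
  (F + F + k) * (F + F + k)          ≤⟨ m≤m+n _ (F * k) ⟩
  (F + F + k) * (F + F + k) + F * k  ≡⟨ expand F k ⟩
  (F + F + k + F + F) * (F + k)      ≤⟨ *-monoˡ-≤ (F + k) n+2F≤e ⟩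
  e * (F + k)                        ≡⟨ cong (e *_) (sym (trans (cong (_∸ F) (+-assoc F F k)) (m+n∸m≡n F (F + k)))) ⟩
  e * (F + F + k ∸ F)                ∎
  where
  open ≤-Reasoning
  expand : ∀ F k → (F + F + k) * (F + F + k) + F * k ≡ (F + F + k + F + F) * (F + k)
  expand = solve-∀

∑-mono-≤ : ∀ {m} {f g : Fin m → ℕ} → (∀ i → f i ≤ g i) → ∑[ i < m ] f i ≤ ∑[ i < m ] g i
∑-mono-≤ {zero}  _   = z≤n
∑-mono-≤ {suc m} f≤g = +-mono-≤ (f≤g zero) (∑-mono-≤ (f≤g ∘ suc))

∑-1 : ∀ m → ∑[ i < m ] 1 ≡ m
∑-1 zero    = refl
∑-1 (suc m) = cong suc (∑-1 m)

∑-sift : ∀ {m} (f : Fin m → ℕ) (a : Fin m) → ∑[ v < m ] (if does (v ≟ a) then f v else 0) ≡ f a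
∑-sift {suc m} f zero    = trans (cong (f zero +_) (sum-replicate-zero m)) (+-identityʳ (f zero))
∑-sift {suc m} f (suc a) = ∑-sift (f ∘ suc) a

∑-remove : ∀ {m} (p : Fin m → Bool) (a : Fin m) →
  ∑[ v < m ] [ p v ] ≡ [ p a ] + ∑[ v < m ] [ not (does (v ≟ a)) ∧ p v ]
∑-remove {m} p a = begin
  ∑[ v < m ] [ p v ]
    ≡⟨ sum-cong-≗ {m} (λ v → split (does (v ≟ a)) (p v)) ⟩
  ∑[ v < m ] ((if does (v ≟ a) then [ p v ] else 0) + [ not (does (v ≟ a)) ∧ p v ])
    ≡⟨ ∑-distrib-+ {m} _ _ ⟩
  ∑[ v < m ] (if does (v ≟ a) then [ p v ] else 0) + ∑[ v < m ] [ not (does (v ≟ a)) ∧ p v ]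
    ≡⟨ cong (_+ ∑[ v < m ] [ not (does (v ≟ a)) ∧ p v ]) (∑-sift (λ v → [ p v ]) a) ⟩
  [ p a ] + ∑[ v < m ] [ not (does (v ≟ a)) ∧ p v ]  ∎
  where
  open ≡-Reasoning
  split : ∀ c b → [ b ] ≡ (if c then [ b ] else 0) + [ not c ∧ b ]
  split true  b = sym (+-identityʳ [ b ])
  split false b = refl

∑∑-distrib-+ : ∀ {m n} (f g : Fin m → Fin n → ℕ) →
  ∑[ i < m ] ∑[ j < n ] (f i j + g i j) ≡ ∑[ i < m ] ∑[ j < n ] f i j + ∑[ i < m ] ∑[ j < n ] g i j
∑∑-distrib-+ {m} {n} f g =
  trans (sum-cong-≗ {m} (λ i → ∑-distrib-+ (f i) (g i))) (∑-distrib-+ {m} (λ i → ∑[ j < n ] f i j) _)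

aboveDiagonal : ∀ {m} → (Fin m → Fin m → ℕ) → Fin m → Fin m → ℕ
aboveDiagonal f u v = if ⌊ u <? v ⌋ then f u v else 0

∑∑-symmetric : ∀ {m} (f : Fin m → Fin m → ℕ) → (∀ u v → f u v ≡ f v u) → (∀ u → f u u ≡ 0) →
  ∑[ u < m ] ∑[ v < m ] f u v ≡ ∑[ u < m ] ∑[ v < m ] aboveDiagonal f u v + ∑[ u < m ] ∑[ v < m ] aboveDiagonal f u v
∑∑-symmetric {m} f f-sym f-diag = begin
  ∑[ u < m ] ∑[ v < m ] f u v
    ≡⟨ sum-cong-≗ {m} (λ u → sum-cong-≗ {m} (split u)) ⟩
  ∑[ u < m ] ∑[ v < m ] (aboveDiagonal f u v + aboveDiagonal f v u)
    ≡⟨ ∑∑-distrib-+ (aboveDiagonal f) (λ u v → aboveDiagonal f v u) ⟩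
  ∑[ u < m ] ∑[ v < m ] aboveDiagonal f u v + ∑[ u < m ] ∑[ v < m ] aboveDiagonal f v u
    ≡⟨ cong (∑[ u < m ] ∑[ v < m ] aboveDiagonal f u v +_) (∑-comm (λ u v → aboveDiagonal f v u)) ⟩
  ∑[ u < m ] ∑[ v < m ] aboveDiagonal f u v + ∑[ u < m ] ∑[ v < m ] aboveDiagonal f u v  ∎
  where
  open ≡-Reasoning
  split : ∀ u v → f u v ≡ aboveDiagonal f u v + aboveDiagonal f v u
  split u v with u <? v | v <? u | <-cmp u v
  ... | yes u<v | yes v<u | _            = contradiction v<u (<-asym u<v)
  ... | yes _   | no _    | _            = sym (+-identityʳ (f u v))
  ... | no _    | yes _   | _            = f-sym u v
  ... | no u≮v  | no _    | tri< u<v _ _ = contradiction u<v u≮v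
  ... | no _    | no _    | tri≈ _ refl _ = f-diag u
  ... | no _    | no v≮u  | tri> _ _ v<u = contradiction v<u v≮u

sum-tabulate : ∀ {m} (f : Fin m → ℕ) → sumᴸ (tabulate f) ≡ ∑[ i < m ] f i
sum-tabulate {zero}  f = refl
sum-tabulate {suc m} f = cong (f zero +_) (sum-tabulate (f ∘ suc))

sum-map-allFin : ∀ {m} (f : Fin m → ℕ) → sumᴸ (map f (allFin m)) ≡ ∑[ i < m ] f i
sum-map-allFin f = trans (cong sumᴸ (map-tabulate id f)) (sum-tabulate f)

sum-concatMap : ∀ {A : Set} (f : A → List ℕ) (xs : List A) →
  sumᴸ (concatMap f xs) ≡ sumᴸ (map (sumᴸ ∘ f) xs)
sum-concatMap f []       = refl
sum-concatMap f (x ∷ xs) =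
  trans (sum-++ (f x) (concatMap f xs)) (cong (sumᴸ (f x) +_) (sum-concatMap f xs))

count≡∑ : ∀ {m} (p : Fin m → Bool) → count p ≡ ∑[ v < m ] [ p v ]
count≡∑ p = sum-map-allFin (λ v → [ p v ])

module _ {m} (G : Graph m) where

  adjacency : Fin m → Fin m → ℕ
  adjacency u v = [ adj G u v ]

  edges≡∑∑ : edges G ≡ ∑[ u < m ] ∑[ v < m ] aboveDiagonal adjacency u v
  edges≡∑∑ = trans (sum-concatMap _ (allFin m))
                   (trans (sum-map-allFin (λ u → sumᴸ (map (aboveDiagonal adjacency u) (allFin m))))
                          (sum-cong-≗ {m} (λ u → sum-map-allFin (aboveDiagonal adjacency u))))

  handshake : ∑[ u < m ] ∑[ v < m ] adjacency u v ≡ edges G + edges G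
  handshake = begin
    ∑[ u < m ] ∑[ v < m ] adjacency u v
      ≡⟨ ∑∑-symmetric adjacency (λ u v → cong [_] (Graph.sym G u v)) (λ u → cong [_] (irrefl G u)) ⟩
    ∑[ u < m ] ∑[ v < m ] aboveDiagonal adjacency u v + ∑[ u < m ] ∑[ v < m ] aboveDiagonal adjacency u v
      ≡⟨ sym (cong₂ _+_ edges≡∑∑ edges≡∑∑) ⟩
    edges G + edges G  ∎
    where open ≡-Reasoning

  adjacent⇒≢ : ∀ {u v} → adj G u v ≡ true → u ≢ v
  adjacent⇒≢ {u} uv refl = contradiction (trans (sym uv) (irrefl G u)) λ ()

module _ {m} {G : Graph m} (M : PerfectMatching G) where

  partner-flip : ∀ {u v} → partner M u ≡ v → u ≡ partner M v
  partner-flip {u} refl = sym (invol M u)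

  partner-injective : ∀ {u v} → partner M u ≡ partner M v → u ≡ v
  partner-injective {v = v} eq = trans (partner-flip eq) (invol M v)

  partner-≢ : ∀ v → v ≢ partner M v
  partner-≢ v = adjacent⇒≢ G (isEdge M v)

  removeEdge : SubMatching M → Fin m → SubMatching M
  removeEdge S x = record
    { covers = covers′
    ; closed = λ v → begin
        covers′ (partner M v)
          ≡⟨ cong₂ (λ a b → not a ∧ (not b ∧ covers S (partner M v)))
                   (does-⇔ (mk⇔ partner-flip (sym ∘ partner-flip ∘ sym)) (partner M v ≟ x) (v ≟ partner M x))
                   (does-⇔ (mk⇔ partner-injective (cong (partner M))) (partner M v ≟ partner M x) (v ≟ x)) ⟩
        not (does (v ≟ partner M x)) ∧ (not (does (v ≟ x)) ∧ covers S (partner M v))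
          ≡⟨ cong (λ c → not (does (v ≟ partner M x)) ∧ (not (does (v ≟ x)) ∧ c)) (closed S v) ⟩
        not (does (v ≟ partner M x)) ∧ (not (does (v ≟ x)) ∧ covers S v)
          ≡⟨ ∧-swap (not (does (v ≟ partner M x))) (not (does (v ≟ x))) (covers S v) ⟩
        covers′ v  ∎
    }
    where
    open ≡-Reasoning
    covers′ : Fin m → Bool
    covers′ v = not (does (v ≟ x)) ∧ (not (does (v ≟ partner M x)) ∧ covers S v)

  module _ (S : SubMatching M) (x : Fin m) where

    removeEdge-covers : ∀ {v} → v ≢ x → v ≢ partner M x → covers S v ≡ true → covers (removeEdge S x) v ≡ true
    removeEdge-covers {v} v≢x v≢Mx v∈S
      rewrite dec-false (v ≟ x) v≢x | dec-false (v ≟ partner M x) v≢Mx = v∈S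

    removeEdge-count : covers S x ≡ true → count (covers S) ≡ 2 + count (covers (removeEdge S x))
    removeEdge-count x∈S = begin
      count (covers S)
        ≡⟨ count≡∑ (covers S) ⟩
      ∑[ v < m ] [ covers S v ]
        ≡⟨ ∑-remove (covers S) (partner M x) ⟩
      [ covers S (partner M x) ] + ∑[ v < m ] [ p v ]
        ≡⟨ cong₂ _+_ (cong [_] (trans (closed S x) x∈S)) (∑-remove p x) ⟩
      1 + ([ p x ] + ∑[ v < m ] [ covers (removeEdge S x) v ])
        ≡⟨ cong (λ b → 1 + ([ b ] + ∑[ v < m ] [ covers (removeEdge S x) v ])) p-x ⟩
      2 + ∑[ v < m ] [ covers (removeEdge S x) v ]
        ≡⟨ cong (2 +_) (sym (count≡∑ (covers (removeEdge S x)))) ⟩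
      2 + count (covers (removeEdge S x))  ∎
      where
      open ≡-Reasoning
      p : Fin m → Bool
      p v = not (does (v ≟ partner M x)) ∧ covers S v
      p-x : p x ≡ true
      p-x rewrite dec-false (x ≟ partner M x) (partner-≢ x) = x∈S

    removeEdge-forcing : IsForcing M S → (∀ w → adj G x w ≡ true → covers S w ≡ true) →
                         IsForcing M (removeEdge S x)
    removeEdge-forcing forcing neighbours-covered M′ agree = forcing M′ agree-on-S
      where
      -- M′ x is a neighbour of x, hence covered by S; unless it is M x it stays covered after
      -- the removal, so M (M′ x) = M′ (M′ x) = x.
      M′x≡Mx : partner M′ x ≡ partner M x
      M′x≡Mx with partner M′ x ≟ partner M x
      ... | yes eq  = eq
      ... | no w≢Mx = contradiction (partner-flip (trans (sym (agree w w∈S′)) (invol M′ x))) w≢Mx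
        where
        w = partner M′ x
        w∈S′ : covers (removeEdge S x) w ≡ true
        w∈S′ = removeEdge-covers (adjacent⇒≢ G (isEdge M′ x) ∘ sym) w≢Mx
                                 (neighbours-covered w (isEdge M′ x))
      agree-on-S : ∀ v → covers S v ≡ true → partner M′ v ≡ partner M v
      agree-on-S v v∈S with v ≟ x | v ≟ partner M x
      ... | yes refl | _        = M′x≡Mx
      ... | no _     | yes refl =
        trans (cong (partner M′) (sym M′x≡Mx)) (trans (invol M′ x) (sym (invol M x)))
      ... | no v≢x   | no v≢Mx  = agree v (removeEdge-covers v≢x v≢Mx v∈S)

  minimum-forcing⇒exits : (S : SubMatching M) → IsForcing M S → ∀ {F} → SizeIs S F →
    (∀ S′ j → IsForcing M S′ → SizeIs S′ j → F ≤ j) →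
    ∀ x → covers S x ≡ true → ∃ λ w → adj G x w ≡ true × covers S w ≡ false
  minimum-forcing⇒exits S forcing {F} size minimal x x∈S
    with any? (λ w → (adj G x w ≟ᵇ true) ×-dec (covers S w ≟ᵇ false))
  ... | yes exit = exit
  ... | no none with half-of-2+ F (trans size (removeEdge-count S x x∈S))
  ...   | k , refl , smaller-size =
    contradiction (minimal (removeEdge S x) k (removeEdge-forcing S x forcing neighbours-covered) smaller-size)
                  (<-irrefl refl)
    where
    neighbours-covered : ∀ w → adj G x w ≡ true → covers S w ≡ true
    neighbours-covered w xw = ¬-not λ w∉S → none (w , xw , w∉S)

  module _ (S : SubMatching M)
           (exits : ∀ x → covers S x ≡ true → ∃ λ w → adj G x w ≡ true × covers S w ≡ false) where

    private
      choice : ∀ x → ∃ λ w → covers S x ≡ true → adj G x w ≡ true × covers S w ≡ false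
      choice x with covers S x in x∈S
      ... | true  = let (w , exits-x) = exits x x∈S in w , λ _ → exits-x
      ... | false = x , λ ()

    exit : Fin m → Fin m
    exit x = proj₁ (choice x)

    exit-adjacent : ∀ {x} → covers S x ≡ true → adj G x (exit x) ≡ true
    exit-adjacent {x} x∈S = proj₁ (proj₂ (choice x) x∈S)

    exit-uncovered : ∀ {x} → covers S x ≡ true → covers S (exit x) ≡ false
    exit-uncovered {x} x∈S = proj₂ (proj₂ (choice x) x∈S)

    matched exitEdge : Fin m → Fin m → ℕ
    matched u v = if does (v ≟ partner M u) then 1 else 0
    exitEdge u v = if does (v ≟ exit u) then [ covers S u ] else 0

    matched-≤ : ∀ u v → matched u v ≤ [ adj G u v ]
    matched-≤ u v with v ≟ partner M u
    ... | yes refl = []-mono {true} λ _ → isEdge M u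
    ... | no _     = z≤n

    matched-≡0 : ∀ {u v} → covers S u ≢ covers S v → matched u v ≡ 0
    matched-≡0 {u} {v} differ with v ≟ partner M u
    ... | yes refl = contradiction (sym (closed S u)) differ
    ... | no _     = refl

    exitEdge-≤ : ∀ u v → exitEdge u v ≤ [ adj G u v ]
    exitEdge-≤ u v with v ≟ exit u
    ... | yes refl = []-mono exit-adjacent
    ... | no _     = z≤n

    exitEdge-from-uncovered : ∀ u v → covers S u ≡ false → exitEdge u v ≡ 0
    exitEdge-from-uncovered u v u∉S with does (v ≟ exit u)
    ... | true  = cong [_] u∉S
    ... | false = refl

    exitEdge-into-covered : ∀ u v → covers S v ≡ true → exitEdge u v ≡ 0
    exitEdge-into-covered u v v∈S with v ≟ exit u
    ... | yes refl = cong [_] (¬-not λ u∈S → contradiction (trans (sym v∈S) (exit-uncovered u∈S)) λ ())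
    ... | no _     = refl

    exitEdge-≡0 : ∀ u v → covers S u ≡ covers S v → exitEdge u v ≡ 0
    exitEdge-≡0 u v same with covers S v ≟ᵇ true
    ... | yes v∈S = exitEdge-into-covered u v v∈S
    ... | no  v∉S = exitEdge-from-uncovered u v (trans same (¬-not v∉S))

    exitEdges-≤ : ∀ u v → exitEdge u v + exitEdge v u ≤ [ adj G u v ]
    exitEdges-≤ u v with covers S v ≟ᵇ true
    ... | yes v∈S rewrite exitEdge-into-covered u v v∈S | Graph.sym G u v = exitEdge-≤ v u
    ... | no  v∉S rewrite exitEdge-from-uncovered v u (¬-not v∉S) | +-identityʳ (exitEdge u v) = exitEdge-≤ u v

    -- Matching edges join vertices of equal coverage, exit edges a covered and an uncovered one.
    pair-≤ : ∀ u v → matched u v + exitEdge u v + exitEdge v u ≤ [ adj G u v ]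
    pair-≤ u v with covers S u ≟ᵇ covers S v
    ... | no differ rewrite matched-≡0 differ = exitEdges-≤ u v
    ... | yes same
      rewrite exitEdge-≡0 u v same | exitEdge-≡0 v u (sym same)
            | +-identityʳ (matched u v) | +-identityʳ (matched u v) = matched-≤ u v

    ∑∑-matched : ∑[ u < m ] ∑[ v < m ] matched u v ≡ m
    ∑∑-matched = trans (sum-cong-≗ {m} λ u → ∑-sift (λ _ → 1) (partner M u)) (∑-1 m)

    ∑∑-exitEdge : ∑[ u < m ] ∑[ v < m ] exitEdge u v ≡ count (covers S)
    ∑∑-exitEdge = trans (sum-cong-≗ {m} λ u → ∑-sift (λ _ → [ covers S u ]) (exit u))
                        (sym (count≡∑ (covers S)))

    matching+exits≤edges+edges : m + count (covers S) + count (covers S) ≤ edges G + edges G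
    matching+exits≤edges+edges = begin
      m + count (covers S) + count (covers S)
        ≡⟨ sym (cong₂ _+_ (cong₂ _+_ ∑∑-matched ∑∑-exitEdge)
                          (trans (∑-comm (λ u v → exitEdge v u)) ∑∑-exitEdge)) ⟩
      ∑[ u < m ] ∑[ v < m ] matched u v + ∑[ u < m ] ∑[ v < m ] exitEdge u v
        + ∑[ u < m ] ∑[ v < m ] exitEdge v u
        ≡⟨ sym (trans (∑∑-distrib-+ (λ u v → matched u v + exitEdge u v) (λ u v → exitEdge v u))
                      (cong (_+ ∑[ u < m ] ∑[ v < m ] exitEdge v u) (∑∑-distrib-+ matched exitEdge))) ⟩
      ∑[ u < m ] ∑[ v < m ] (matched u v + exitEdge u v + exitEdge v u)
        ≤⟨ ∑-mono-≤ (λ u → ∑-mono-≤ (pair-≤ u)) ⟩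
      ∑[ u < m ] ∑[ v < m ] [ adj G u v ]
        ≡⟨ handshake G ⟩
      edges G + edges G  ∎
      where open ≤-Reasoning

proposition5p2 : ∀ (n : ℕ) (G : Graph (n + n)) → PerfectMatching G →
    ∀ (F : ℕ) → IsMaxForcingNumber G F → F + F ≤ n →
    n * n ≤ edges G * (n ∸ F)
proposition5p2 n G _ F ((M , (S , forcing , size) , minimal) , _) 2F≤n =
  square-≤ {e = edges G} 2F≤n (m+m≤n+n⇒m≤n (begin
    (n + F + F) + (n + F + F)                   ≡⟨ regroup n F ⟩
    n + n + (F + F) + (F + F)                   ≡⟨ cong (λ c → n + n + c + c) size ⟩
    n + n + count (covers S) + count (covers S) ≤⟨ matching+exits≤edges+edges M S (minimum-forcing⇒exits M S forcing size minimal) ⟩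
    edges G + edges G                           ∎))
  where
  open ≤-Reasoning
  regroup : ∀ n F → (n + F + F) + (n + F + F) ≡ n + n + (F + F) + (F + F)
  regroup = solve-∀
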